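{- (Provable in $\mathsf{RCA}_0$.) For every recurrent coloring $f:\operatorname{FIN}_A\to C$ there is an infinite block sequence $X\subseteq\operatorname{FIN}_{A\star}$ such that $f(p)=f(\emptyset)$ for every $p\in[X]_A$.
   Context: $A$ finite nonempty alphabet, $C$ finite nonempty color set, $\star\notin A$. A located word is a function from a finite subset of $\mathbb{N}$ into $A$; here the empty located word $\emptyset$ is included ($\emptyset\cup p=p$), $\operatorname{FIN}_A$ is the set of located words and colorings are maps $\operatorname{FIN}_A\to C$. A located variable word is a function from a finite nonempty subset of $\mathbb{N}$ into $A\cup\{\star\}$ taking value $\star$ at least once; $\operatorname{FIN}_{A\star}$ is their set; for $a\in A$, $p[a]$ replaces each $\star$ by $a$. $p<q$ means $\max\operatorname{dom}p<\min\operatorname{dom}q$, and then $p\cup q$ is the union. A block sequence is a subset of $\operatorname{FIN}_{A\star}$ totally ordered by $<$; $[X]_A$ is the set of all $p_0[a_0]\cup\dots\cup p_k[a_k]$ with $p_0<\dots<p_k$ in $X$, $a_j\in A$. $\operatorname{FIN}_A(m,n)$, $\operatorname{FIN}_{A\star}(m,n)$ denote located (variable) words with domain in $[m,n)$. For $p\in\operatorname{FIN}_A(\ell,\infty)$, $S^\ell_p(f)(q)=f(q\cup p)$ for $q\in\operatorname{FIN}_A(0,\ell)$; $S^\ell(f)=S^\ell_\emptyset(f)$. $f$ is recurrent if for every $\ell$ there is $p\in\operatorname{FIN}_{A\star}(\ell,\infty)$ with $S^\ell_{p[a]}(f)=S^\ell(f)$ for every $a\in A$. -}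

module Defs where

open import Data.Nat using (ℕ; zero; suc; _≤_; _<_)
open import Data.Fin using (Fin)
open import Data.Bool using (T)
open import Data.Maybe using (Maybe; just; nothing; is-just)
import Data.Maybe as Maybe
open import Data.List using (List; []; _∷_; length; take; map; foldr)
open import Data.List.Relation.Unary.All using (All)
open import Data.List.Relation.Unary.Any using (Any)
open import Data.List.Relation.Unary.Linked using (Linked)
open import Data.Product using (Σ; _×_; _,_; proj₁)
open import Data.Unit using (⊤)
open import Relation.Binary.PropositionalEquality using (_≡_)

-- A located word over X is a finite partial function ℕ ⇀ X.  We encode it as
-- a list  w : List (Maybe X)  where position i carries  just x  iff i ↦ x,
-- and  nothing  iff i ∉ dom.  The list is *normal* when its last entry is a
-- `just` (no trailing `nothing`s); normal lists are in bijection with located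
-- words.

Normal : {X : Set} → List (Maybe X) → Set
Normal []           = ⊤
Normal (x ∷ [])     = T (is-just x)
Normal (x ∷ y ∷ xs) = Normal (y ∷ xs)

data Sym (A : Set) : Set where
  ltr  : A → Sym A
  star : Sym A

Word : Set → Set
Word A = List (Maybe A)

VWord : Set → Set
VWord A = List (Maybe (Sym A))

IsVarWord : {A : Set} → VWord A → Set
IsVarWord p = Normal p × Any (λ x → x ≡ just star) p

From : {X : Set} → ℕ → List (Maybe X) → Set
From ℓ p = All (λ x → x ≡ nothing) (take ℓ p)

-- dom q ⊆ [0, ℓ)   (for normal q, max dom q = length q - 1)
Below : {X : Set} → ℕ → List (Maybe X) → Set
Below ℓ q = length q ≤ ℓ

-- p < q : max dom p < min dom q, i.e. q has no letters at positions < length p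
Before : {X Y : Set} → List (Maybe X) → List (Maybe Y) → Set
Before p q = All (λ x → x ≡ nothing) (take (length p) q)

substSym : {A : Set} → A → Sym A → A
substSym a (ltr b) = b
substSym a star    = a

_[_] : {A : Set} → VWord A → A → Word A
p [ a ] = map (Maybe.map (substSym a)) p

-- union of located words (used only for words with disjoint domains)
_∪_ : {A : Set} → Word A → Word A → Word A
[]           ∪ q       = q
(x ∷ p)      ∪ []      = x ∷ p
(just a ∷ p) ∪ (_ ∷ q) = just a ∷ (p ∪ q)
(nothing ∷ p) ∪ (y ∷ q) = y ∷ (p ∪ q)

-- f is recurrent: for every ℓ there is p ∈ FIN_{A⋆}(ℓ,∞) such that for every
-- a ∈ A, S^ℓ_{p[a]}(f) = S^ℓ(f), i.e. f(q ∪ p[a]) = f(q ∪ ∅) = f(q) for all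
-- q ∈ FIN_A(0,ℓ).
Recurrent : {A C : Set} → (Word A → C) → Set
Recurrent {A} f =
  (ℓ : ℕ) → Σ (VWord A) λ p → IsVarWord p × From ℓ p ×
    ((a : A) (q : Word A) → Normal q → Below ℓ q → f (q ∪ (p [ a ])) ≡ f q)

-- An infinite block sequence, given by its increasing enumeration X 0 < X 1 < …
BlockSeq : {A : Set} → (ℕ → VWord A) → Set
BlockSeq X = ((n : ℕ) → IsVarWord (X n)) × ((n : ℕ) → Before (X n) (X (suc n)))

-- Elements of [X]_A are described by a nonempty list ((i₀,a₀) … (i_k,a_k))
-- with i₀ < … < i_k, denoting X i₀ [a₀] ∪ … ∪ X i_k [a_k].
IncreasingIdx : {A : Set} → List (ℕ × A) → Set
IncreasingIdx = Linked (λ x y → proj₁ x < proj₁ y)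

combine : {A : Set} → (ℕ → VWord A) → List (ℕ × A) → Word A
combine X = foldr (λ { (i , a) w → (X i [ a ]) ∪ w }) []

-- Choose the witnesses of recurrence one after another, each beyond everything chosen
-- so far: X n is a recurrence witness for a level L n exceeding the domains of
-- X 0, …, X (n-1).  Then every  q ∪ X i [a] ∪ …  can be peeled from the left: q ∪ X i [a]
-- is a word below L (i+1) ≤ L j for the next index j, so by induction f of the whole
-- union equals f (q ∪ X i [a]), which recurrence at level L i identifies with f q.
-- Starting from q = ∅ gives f p = f ∅ for every p ∈ [X]_A.
module Submission where

open import Defs
open import Data.Nat using (ℕ; zero; suc; _≤_; _⊔_; _≤′_; ≤′-refl; ≤′-step; z≤n; s≤s)
open import Data.Nat.Properties using (≤-refl; ≤-trans; <⇒≤; m≤m⊔n; m≤n⊔m; ≤⇒≤′; m≤n⇒m⊓n≡m)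
open import Data.Fin using (Fin)
open import Data.List using (List; []; _∷_; length; take; map)
open import Data.List.Properties using (length-map; take-take)
open import Data.List.Relation.Unary.All using (All)
open import Data.List.Relation.Unary.All.Properties using (take⁺)
open import Data.List.Relation.Unary.Linked using (_∷_)
open import Data.Maybe using (Maybe; just; nothing; is-just)
import Data.Maybe as Maybe
open import Data.Bool using (T)
open import Data.Unit using (tt)
open import Data.Product using (Σ; _×_; _,_; proj₁; proj₂)
open import Relation.Binary.PropositionalEquality
  using (_≡_; _≢_; refl; sym; trans; cong; subst; module ≡-Reasoning)
open import Relation.Nullary using (contradiction)

module _ {A : Set} where

  ∪-identityʳ : (p : Word A) → p ∪ [] ≡ p
  ∪-identityʳ []      = refl
  ∪-identityʳ (_ ∷ _) = refl

  ∪-assoc : (p q r : Word A) → (p ∪ q) ∪ r ≡ p ∪ (q ∪ r)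
  ∪-assoc []            q             r       = refl
  ∪-assoc (_ ∷ _)       []            r       = refl
  ∪-assoc (just _ ∷ _)  (_ ∷ _)       []      = refl
  ∪-assoc (nothing ∷ _) (_ ∷ _)       []      = refl
  ∪-assoc (just a ∷ p)  (just _ ∷ q)  (_ ∷ r) = cong (just a ∷_) (∪-assoc p q r)
  ∪-assoc (just a ∷ p)  (nothing ∷ q) (_ ∷ r) = cong (just a ∷_) (∪-assoc p q r)
  ∪-assoc (nothing ∷ p) (just b ∷ q)  (_ ∷ r) = cong (just b ∷_) (∪-assoc p q r)
  ∪-assoc (nothing ∷ p) (nothing ∷ q) (w ∷ r) = cong (w ∷_) (∪-assoc p q r)

  ∪-≡[]ʳ : (p q : Word A) → p ∪ q ≡ [] → q ≡ []
  ∪-≡[]ʳ []            q       eq = eq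
  ∪-≡[]ʳ (_ ∷ _)       []      _  = refl
  ∪-≡[]ʳ (just _ ∷ _)  (_ ∷ _) ()
  ∪-≡[]ʳ (nothing ∷ _) (_ ∷ _) ()

  length-∪-≤ : ∀ {n} (p q : Word A) → length p ≤ n → length q ≤ n → length (p ∪ q) ≤ n
  length-∪-≤ []            q       _          lq         = lq
  length-∪-≤ (_ ∷ _)       []      lp         _          = lp
  length-∪-≤ (just _ ∷ p)  (_ ∷ q) (s≤s lp) (s≤s lq) = s≤s (length-∪-≤ p q lp lq)
  length-∪-≤ (nothing ∷ p) (_ ∷ q) (s≤s lp) (s≤s lq) = s≤s (length-∪-≤ p q lp lq)

module _ {X : Set} where

  Normal-tail : {x : Maybe X} (xs : List (Maybe X)) → Normal (x ∷ xs) → Normal xs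
  Normal-tail []      _  = tt
  Normal-tail (_ ∷ _) nx = nx

  Normal-cons : {x : Maybe X} (xs : List (Maybe X)) →
                Normal xs → (xs ≡ [] → T (is-just x)) → Normal (x ∷ xs)
  Normal-cons []      _  last = last refl
  Normal-cons (_ ∷ _) nx _    = nx

  Normal-map : {Y : Set} (g : X → Y) (xs : List (Maybe X)) →
               Normal xs → Normal (map (Maybe.map g) xs)
  Normal-map g []               _  = tt
  Normal-map g (just _ ∷ [])    _  = tt
  Normal-map g (_ ∷ x′ ∷ xs)    nx = Normal-map g (x′ ∷ xs) nx

Normal-∪ : {A : Set} (p q : Word A) → Normal p → Normal q → Normal (p ∪ q)
Normal-∪ []            q       _  nq = nq
Normal-∪ (_ ∷ _)       []      np _  = np
Normal-∪ (just _ ∷ p)  (_ ∷ q) np nq =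
  Normal-cons (p ∪ q) (Normal-∪ p q (Normal-tail p np) (Normal-tail q nq)) (λ _ → tt)
Normal-∪ (nothing ∷ p) (y ∷ q) np nq =
  Normal-cons (p ∪ q) (Normal-∪ p q (Normal-tail p np) (Normal-tail q nq))
    (λ p∪q≡[] → subst (λ r → Normal (y ∷ r)) (∪-≡[]ʳ p q p∪q≡[]) nq)

subst-normal : {A : Set} (a : A) (p : VWord A) → Normal p → Normal (p [ a ])
subst-normal a = Normal-map (substSym a)

length-subst : {A : Set} (a : A) (p : VWord A) → length (p [ a ]) ≡ length p
length-subst a = length-map (Maybe.map (substSym a))

From-≤ : {X : Set} {m n : ℕ} (p : List (Maybe X)) → n ≤ m → From m p → From n p
From-≤ {m = m} {n} p n≤m from =
  subst (All (_≡ nothing)) (trans (take-take n m p) (cong (λ k → take k p) (m≤n⇒m⊓n≡m n≤m)))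
    (take⁺ n from)

stepwise-monotone : (L : ℕ → ℕ) → (∀ n → L n ≤ L (suc n)) → ∀ {m n} → m ≤ n → L m ≤ L n
stepwise-monotone L step m≤n = go (≤⇒≤′ m≤n)
  where
  go : ∀ {m n} → m ≤′ n → L m ≤ L n
  go ≤′-refl          = ≤-refl
  go (≤′-step {n} m≤n) = ≤-trans (go m≤n) (step n)

module RecurrentBlocks {A C : Set} (f : Word A → C) (rec : Recurrent f) where

  witness : ℕ → VWord A
  witness ℓ = proj₁ (rec ℓ)

  witness-isVarWord : ∀ ℓ → IsVarWord (witness ℓ)
  witness-isVarWord ℓ = proj₁ (proj₂ (rec ℓ))

  witness-from : ∀ ℓ → From ℓ (witness ℓ)
  witness-from ℓ = proj₁ (proj₂ (proj₂ (rec ℓ)))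

  witness-absorbed : ∀ ℓ (a : A) (q : Word A) → Normal q → Below ℓ q →
                     f (q ∪ (witness ℓ [ a ])) ≡ f q
  witness-absorbed ℓ = proj₂ (proj₂ (proj₂ (rec ℓ)))

  level : ℕ → ℕ
  level zero    = 0
  level (suc n) = level n ⊔ length (witness (level n))

  blocks : ℕ → VWord A
  blocks n = witness (level n)

  level-monotone : ∀ {m n} → m ≤ n → level m ≤ level n
  level-monotone = stepwise-monotone level (λ n → m≤m⊔n (level n) (length (blocks n)))

  length-blocks≤level : ∀ n → length (blocks n) ≤ level (suc n)
  length-blocks≤level n = m≤n⊔m (level n) (length (blocks n))

  blocks-blockSeq : BlockSeq blocks
  blocks-blockSeq =
      (λ n → witness-isVarWord (level n))
    , (λ n → From-≤ (blocks (suc n)) (length-blocks≤level n) (witness-from (level (suc n))))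

  absorb-combine : (i : ℕ) (a : A) (ps : List (ℕ × A)) → IncreasingIdx ((i , a) ∷ ps) →
                   (q : Word A) → Normal q → Below (level i) q →
                   f (q ∪ combine blocks ((i , a) ∷ ps)) ≡ f q
  absorb-combine i a [] _ q nq q<ℓ =
    trans (cong (λ w → f (q ∪ w)) (∪-identityʳ (blocks i [ a ]))) (witness-absorbed (level i) a q nq q<ℓ)
  absorb-combine i a ((j , b) ∷ ps) (i<j ∷ incr) q nq q<ℓ = begin
    f (q ∪ ((blocks i [ a ]) ∪ rest)) ≡⟨ cong f (∪-assoc q (blocks i [ a ]) rest) ⟨
    f (q′ ∪ rest)                     ≡⟨ absorb-combine j b ps incr q′ nq′ q′<ℓ ⟩
    f q′                              ≡⟨ witness-absorbed (level i) a q nq q<ℓ ⟩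
    f q                               ∎
    where
    open ≡-Reasoning
    rest : Word A
    rest = combine blocks ((j , b) ∷ ps)
    q′ : Word A
    q′ = q ∪ (blocks i [ a ])
    nq′ : Normal q′
    nq′ = Normal-∪ q _ nq (subst-normal a (blocks i) (proj₁ (witness-isVarWord (level i))))
    q′<ℓ : Below (level j) q′
    q′<ℓ = length-∪-≤ q _
      (≤-trans q<ℓ (level-monotone (<⇒≤ i<j)))
      (≤-trans (subst (_≤ _) (sym (length-subst a (blocks i))) (length-blocks≤level i))
               (level-monotone i<j))

lemma4p3 : (k c : ℕ) (f : Word (Fin (suc k)) → Fin (suc c)) → Recurrent f →
    Σ (ℕ → VWord (Fin (suc k))) λ X → BlockSeq X ×
      ((ps : List (ℕ × Fin (suc k))) → ps ≢ [] → IncreasingIdx ps →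
        f (combine X ps) ≡ f [])
lemma4p3 k c f rec = blocks , blocks-blockSeq , absorbed
  where
  open RecurrentBlocks f rec
  absorbed : (ps : List (ℕ × Fin (suc k))) → ps ≢ [] → IncreasingIdx ps →
             f (combine blocks ps) ≡ f []
  absorbed []             ps≢[] _    = contradiction refl ps≢[]
  absorbed ((i , a) ∷ ps) _     incr = absorb-combine i a ps incr [] tt z≤n
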